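{- Let $p\in\mathrm{OFS}(\mathbb{Z}^+)$ be trim with $|p|>1$. Then $f(p)>\max(p)$. In addition, if $R(p)$ is not trim, then $f(p)=2p_1$.
   Context: $\mathrm{OFS}(\mathbb{Z}^+)$ denotes the set of all nonempty strictly increasing finite sequences of positive integers. For $p\in\mathrm{OFS}(\mathbb{Z}^+)$, $|p|$ is its length, $p_i$ its $i$-th entry, $p|_i=(p_1,\ldots,p_i)$, $\gcd(p)$ the gcd of its entries, $\max(p)=p_{|p|}$. The map $R$: $R(p)=p$ if $|p|=1$; if $n=|p|>1$, form $(p_2-p_1,\ldots,p_n-p_1)$ and, if $p_1$ does not appear in it, insert $p_1$ so that the result is strictly increasing. $f$ is defined recursively by $f(p)=p_1$ if $|p|=1$ and $f(p)=p_1+f(R(p))$ if $|p|>1$. A sequence $p$ is trim if either $|p|=1$, or $n=|p|>1$ and either $\gcd(p)\ne\gcd(p|_{n-1})$, or $\gcd(p)=\gcd(p|_{n-1})$ and $\max(p)<f(p|_{n-1})$. -}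

module Defs where

open import Data.Nat using (ℕ; zero; suc; _+_; _∸_; _<_; _⊔_; _<ᵇ_; _≡ᵇ_)
open import Data.Nat.GCD using (gcd)
open import Data.Bool using (if_then_else_)
open import Data.List using (List; []; _∷_; map; foldr; length; take)
open import Data.List.Relation.Unary.All using (All)
open import Data.List.Relation.Unary.Linked using (Linked)
open import Data.Product using (_×_)
open import Data.Sum using (_⊎_)
open import Relation.Binary.PropositionalEquality using (_≡_; _≢_)

OFS : List ℕ → Set
OFS []       = Data.Empty.⊥ where import Data.Empty
OFS (x ∷ xs) = All (0 <_) (x ∷ xs) × Linked _<_ (x ∷ xs)

maxL : List ℕ → ℕ
maxL = foldr _⊔_ 0

gcdL : List ℕ → ℕ
gcdL = foldr gcd 0

prefix : List ℕ → List ℕ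
prefix p = take (length p ∸ 1) p

insertIfAbsent : ℕ → List ℕ → List ℕ
insertIfAbsent x []       = x ∷ []
insertIfAbsent x (y ∷ ys) =
  if x <ᵇ y then x ∷ y ∷ ys
  else if x ≡ᵇ y then y ∷ ys
  else y ∷ insertIfAbsent x ys

R : List ℕ → List ℕ
R []           = []
R (x ∷ [])     = x ∷ []
R (x ∷ y ∷ ys) = insertIfAbsent x (map (λ z → z ∸ x) (y ∷ ys))

-- f with fuel; on an OFS, max strictly decreases under R, so
-- fuel suc (max p) is always enough and the value is independent of it.
fFuel : ℕ → List ℕ → ℕ
fFuel zero    _            = 0
fFuel (suc k) []           = 0
fFuel (suc k) (x ∷ [])     = x
fFuel (suc k) (x ∷ y ∷ ys) = x + fFuel k (R (x ∷ y ∷ ys))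

f : List ℕ → ℕ
f p = fFuel (suc (maxL p)) p

Trim : List ℕ → Set
Trim p = length p ≡ 1
       ⊎ (1 < length p
          × (gcdL p ≢ gcdL (prefix p)
             ⊎ (gcdL p ≡ gcdL (prefix p) × maxL p < f (prefix p))))

module Submission where

-- Write R(x ∷ l) = shift x l: subtract x from the tail and insert x.  Since
-- insertion does not change max or gcd, max (shift x l) = x ⊔ (max l ∸ x) and
-- gcd (shift x l) = gcd (x ∷ l).  As max drops strictly under R, strong
-- induction on max is available; it gives f(x ∷ l) = x + f(shift x l) and
-- max q ≤ f q for every increasing q.
--
-- The heart of the file is the trim criterion: an increasing a ∷ m ∷ʳ b is
-- trim iff b < f(a ∷ m ∷ʳ b).  It is proved by strong induction on b,
-- comparing b with 2a: below 2a both sides hold, at 2a the last entry is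
-- invisible to gcd and to R, and above 2a applying R to both a ∷ m ∷ʳ b and
-- a ∷ m turns the question into the same one for the smaller last entry b ∸ a.
--
-- The first claim is the criterion itself.  For the second, a non-trim
-- increasing q has f q = max q, so f p = x + (x ⊔ (max p ∸ x)); as this
-- exceeds max p the maximum is x, whence f p = 2x.

open import Defs
open import Data.Nat
open import Data.Nat.Properties
open import Data.Nat.Divisibility
open import Data.Nat.GCD
open import Data.Nat.Induction using (<-rec; <-wellFounded)
open import Data.Bool using (true; false; T; if_then_else_)
open import Data.Unit using (tt)
open import Data.List using (List; []; _∷_; map; foldr; length; _∷ʳ_; initLast; _∷ʳ′_)
open import Data.List.Properties using (map-++)
open import Data.List.Relation.Unary.All as All using (All; []; _∷_)
import Data.List.Relation.Unary.All.Properties as All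
open import Data.List.Relation.Unary.AllPairs using (AllPairs; []; _∷_)
open import Data.List.Relation.Unary.Linked.Properties using (Linked⇒AllPairs)
open import Data.Product using (_×_; _,_; ∃₂)
import Data.Product as Product
open import Data.Sum using (_⊎_; inj₁; inj₂)
import Data.Sum as Sum
open import Function.Bundles using (_⇔_; mk⇔; Equivalence)
open import Function.Construct.Symmetry using (⇔-sym)
open import Function.Related.Propositional using (module EquationalReasoning)
open import Induction.WellFounded using (Acc; acc)
open import Relation.Nullary using (¬_; yes; no; contradiction)
open import Relation.Binary.Definitions using (tri<; tri≈; tri>)
open import Relation.Binary.PropositionalEquality
open import Algebra.Definitions {A = ℕ} _≡_ using (Associative; Commutative; Idempotent)

open Equivalence using (to; from)

⊔≡+∸ : ∀ m n → m ⊔ n ≡ m + (n ∸ m)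
⊔≡+∸ m n with ≤-total m n
... | inj₁ m≤n = trans (m≤n⇒m⊔n≡n m≤n) (sym (m+[n∸m]≡n m≤n))
... | inj₂ n≤m = trans (m≥n⇒m⊔n≡m n≤m)
                   (sym (trans (cong (m +_) (m≤n⇒m∸n≡0 n≤m)) (+-identityʳ m)))

∸<⇔<+ : ∀ {a b x} → a ≤ b → (b ∸ a < x ⇔ b < a + x)
∸<⇔<+ {a} {b} {x} a≤b = mk⇔
  (λ lt → subst (_< a + x) (m+[n∸m]≡n a≤b) (+-monoʳ-< a lt))
  (λ lt → subst (b ∸ a <_) (m+n∸m≡n a x) (∸-monoˡ-< lt a≤b))

∣m∣n⇒∣m∸n : ∀ {d m n} → n ≤ m → d ∣ m → d ∣ n → d ∣ m ∸ n
∣m∣n⇒∣m∸n {d} n≤m d∣m d∣n = ∣m+n∣m⇒∣n (subst (d ∣_) (sym (m+[n∸m]≡n n≤m)) d∣m) d∣n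

∣<⇒+≤ : ∀ {a b} → a ∣ b → a < b → a + a ≤ b
∣<⇒+≤ {a} {b} a∣b a<b = m≤o∸n⇒m+n≤o a (<⇒≤ a<b)
  (∣⇒≤ {{>-nonZero (m<n⇒0<n∸m a<b)}} (∣m∣n⇒∣m∸n (<⇒≤ a<b) a∣b ∣-refl))

gcd-idem : Idempotent gcd
gcd-idem n = ∣-antisym (gcd[m,n]∣m n n) (gcd-greatest ∣-refl ∣-refl)

if-true : ∀ {A : Set} {b} {u v : A} → T b → (if b then u else v) ≡ u
if-true {b = true} _ = refl

if-false : ∀ {A : Set} {b} {u v : A} → ¬ T b → (if b then u else v) ≡ v
if-false {b = true}  ¬t = contradiction tt ¬t
if-false {b = false} _  = refl

insert-< : ∀ {x y} ys → x < y → insertIfAbsent x (y ∷ ys) ≡ x ∷ y ∷ ys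
insert-< _ x<y = if-true (<⇒<ᵇ x<y)

insert-≡ : ∀ x ys → insertIfAbsent x (x ∷ ys) ≡ x ∷ ys
insert-≡ x _ = trans (if-false (λ t → <-irrefl refl (<ᵇ⇒< x x t))) (if-true (≡⇒≡ᵇ x x refl))

insert-> : ∀ {x y} ys → y < x → insertIfAbsent x (y ∷ ys) ≡ y ∷ insertIfAbsent x ys
insert-> {x} {y} _ y<x =
  trans (if-false (λ t → <-asym (<ᵇ⇒< x y t) y<x))
        (if-false (λ t → <-irrefl (sym (≡ᵇ⇒≡ x y t)) y<x))

insert-All⁺ : ∀ {P : ℕ → Set} {x} L → P x → All P L → All P (insertIfAbsent x L)
insert-All⁺ [] px [] = px ∷ []
insert-All⁺ {x = x} (y ∷ ys) px (py ∷ pys) with <-cmp x y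
... | tri< x<y _ _ rewrite insert-< ys x<y = px ∷ py ∷ pys
... | tri≈ _ refl _ rewrite insert-≡ x ys = py ∷ pys
... | tri> _ _ y<x rewrite insert-> ys y<x = py ∷ insert-All⁺ ys px pys

insert-sorted : ∀ x {L} → AllPairs _<_ L → AllPairs _<_ (insertIfAbsent x L)
insert-sorted x [] = [] ∷ []
insert-sorted x {y ∷ ys} (y<ys ∷ s) with <-cmp x y
... | tri< x<y _ _ rewrite insert-< ys x<y = (x<y ∷ All.map (<-trans x<y) y<ys) ∷ y<ys ∷ s
... | tri≈ _ refl _ rewrite insert-≡ x ys = y<ys ∷ s
... | tri> _ _ y<x rewrite insert-> ys y<x = insert-All⁺ ys y<x y<ys ∷ insert-sorted x s

-- Folding a semilattice operation over a list does not see whether x was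
-- already present, so insertion just combines x with the fold.  This gives
-- the max and the gcd of R.
module _ (_∙_ : ℕ → ℕ → ℕ) (assoc : Associative _∙_) (comm : Commutative _∙_)
         (idem : Idempotent _∙_) where

  fold-insert : ∀ e x L → foldr _∙_ e (insertIfAbsent x L) ≡ x ∙ foldr _∙_ e L
  fold-insert e x [] = refl
  fold-insert e x (y ∷ ys) with <-cmp x y
  ... | tri< x<y _ _ rewrite insert-< ys x<y = refl
  ... | tri≈ _ refl _ rewrite insert-≡ x ys =
    trans (cong (_∙ foldr _∙_ e ys) (sym (idem x))) (assoc x x _)
  ... | tri> _ _ y<x rewrite insert-> ys y<x = begin
    y ∙ foldr _∙_ e (insertIfAbsent x ys) ≡⟨ cong (y ∙_) (fold-insert e x ys) ⟩
    y ∙ (x ∙ F)                            ≡⟨ sym (assoc y x F) ⟩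
    (y ∙ x) ∙ F                            ≡⟨ cong (_∙ F) (comm y x) ⟩
    (x ∙ y) ∙ F                            ≡⟨ assoc x y F ⟩
    x ∙ (y ∙ F)                            ∎
    where open ≡-Reasoning
          F = foldr _∙_ e ys

insert-nonempty : ∀ x L → ∃₂ λ c K → insertIfAbsent x L ≡ c ∷ K
insert-nonempty x [] = x , [] , refl
insert-nonempty x (y ∷ ys) with <-cmp x y
... | tri< x<y _ _ = x , y ∷ ys , insert-< ys x<y
... | tri≈ _ refl _ = x , ys , insert-≡ x ys
... | tri> _ _ y<x = y , insertIfAbsent x ys , insert-> ys y<x

insert-∷ʳ : ∀ {x z} L → x < z → insertIfAbsent x (L ∷ʳ z) ≡ insertIfAbsent x L ∷ʳ z
insert-∷ʳ [] x<z = insert-< [] x<z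
insert-∷ʳ {x} (y ∷ ys) x<z with <-cmp x y
... | tri< x<y _ _ = trans (insert-< (ys ∷ʳ _) x<y) (cong (_∷ʳ _) (sym (insert-< ys x<y)))
... | tri≈ _ refl _ = trans (insert-≡ x (ys ∷ʳ _)) (cong (_∷ʳ _) (sym (insert-≡ x ys)))
... | tri> _ _ y<x = trans (insert-> (ys ∷ʳ _) y<x)
                       (trans (cong (y ∷_) (insert-∷ʳ ys x<z)) (cong (_∷ʳ _) (sym (insert-> ys y<x))))

insert-above : ∀ {x} L → All (_< x) L → insertIfAbsent x L ≡ L ∷ʳ x
insert-above [] [] = refl
insert-above (y ∷ ys) (y<x ∷ ys<x) = trans (insert-> ys y<x) (cong (y ∷_) (insert-above ys ys<x))

insert-idem : ∀ x L → insertIfAbsent x (insertIfAbsent x L) ≡ insertIfAbsent x L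
insert-idem x [] = insert-≡ x []
insert-idem x (y ∷ ys) with <-cmp x y
... | tri< x<y _ _ rewrite insert-< ys x<y = insert-≡ x (y ∷ ys)
... | tri≈ _ refl _ rewrite insert-≡ x ys = insert-≡ x ys
... | tri> _ _ y<x rewrite insert-> ys y<x | insert-> (insertIfAbsent x ys) y<x =
  cong (y ∷_) (insert-idem x ys)

maxL-∷ʳ : ∀ {b} xs → All (_≤ b) xs → maxL (xs ∷ʳ b) ≡ b
maxL-∷ʳ {b} [] [] = ⊔-identityʳ b
maxL-∷ʳ (x ∷ xs) (x≤b ∷ xs≤b) = trans (cong (x ⊔_) (maxL-∷ʳ xs xs≤b)) (m≤n⇒m⊔n≡n x≤b)

maxL-map-∸ : ∀ x L → maxL (map (_∸ x) L) ≡ maxL L ∸ x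
maxL-map-∸ x [] = sym (0∸n≡0 x)
maxL-map-∸ x (y ∷ ys) =
  trans (cong ((y ∸ x) ⊔_) (maxL-map-∸ x ys)) (sym (∸-distribʳ-⊔ x y (maxL ys)))

∣gcdL⇔ : ∀ {d} l → d ∣ gcdL l ⇔ All (d ∣_) l
∣gcdL⇔ l = mk⇔ (divides-all l) (all-divides l)
  where
  divides-all : ∀ {d} l → d ∣ gcdL l → All (d ∣_) l
  divides-all [] _ = []
  divides-all (x ∷ l) d∣g = ∣-trans d∣g (gcd[m,n]∣m x (gcdL l))
                          ∷ divides-all l (∣-trans d∣g (gcd[m,n]∣n x (gcdL l)))
  all-divides : ∀ {d} l → All (d ∣_) l → d ∣ gcdL l
  all-divides [] [] = _ ∣0
  all-divides (x ∷ l) (d∣x ∷ d∣l) = gcd-greatest d∣x (all-divides l d∣l)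

gcdL-unique : ∀ l l′ → (∀ {d} → All (d ∣_) l ⇔ All (d ∣_) l′) → gcdL l ≡ gcdL l′
gcdL-unique l l′ same = ∣-antisym
  (from (∣gcdL⇔ l′) (to same (to (∣gcdL⇔ l) ∣-refl)))
  (from (∣gcdL⇔ l) (from same (to (∣gcdL⇔ l′) ∣-refl)))

gcdL-∷ʳ : ∀ xs b → (∀ {d} → All (d ∣_) xs → d ∣ b) → gcdL (xs ∷ʳ b) ≡ gcdL xs
gcdL-∷ʳ xs b redundant = gcdL-unique (xs ∷ʳ b) xs
  (mk⇔ (λ h → Product.proj₁ (All.∷ʳ⁻ h)) (λ h → All.∷ʳ⁺ h (redundant h)))

-- Strictly increasing lists of positive integers; OFS with Linked unfolded
-- into all pairs, which is the form preserved by insertion.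
Increasing : List ℕ → Set
Increasing p = AllPairs _<_ p × All (0 <_) p

ofs⇒increasing : ∀ {x xs} → OFS (x ∷ xs) → Increasing (x ∷ xs)
ofs⇒increasing (pos , linked) = Linked⇒AllPairs <-trans linked , pos

∷ʳ-increasing⁻ : ∀ xs {b} → Increasing (xs ∷ʳ b) → Increasing xs × All (_< b) xs
∷ʳ-increasing⁻ [] _ = ([] , []) , []
∷ʳ-increasing⁻ (x ∷ xs) (x<rest ∷ sorted , 0<x ∷ pos)
  with All.∷ʳ⁻ x<rest | ∷ʳ-increasing⁻ xs (sorted , pos)
... | x<xs , x<b | (sorted′ , pos′) , xs<b = (x<xs ∷ sorted′ , 0<x ∷ pos′) , x<b ∷ xs<b

init-increasing : ∀ xs {b} → Increasing (xs ∷ʳ b) → Increasing xs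
init-increasing xs inc = Product.proj₁ (∷ʳ-increasing⁻ xs inc)

below-last : ∀ xs {b} → Increasing (xs ∷ʳ b) → All (_< b) xs
below-last xs inc = Product.proj₂ (∷ʳ-increasing⁻ xs inc)

maxL-last : ∀ xs {b} → Increasing (xs ∷ʳ b) → maxL (xs ∷ʳ b) ≡ b
maxL-last xs inc = maxL-∷ʳ xs (All.map <⇒≤ (below-last xs inc))

∷ʳ≢[] : ∀ xs {b : ℕ} → xs ∷ʳ b ≢ []
∷ʳ≢[] [] ()
∷ʳ≢[] (_ ∷ _) ()

-- R (x ∷ l) for a nonempty tail l, written so that it computes for every l.
shift : ℕ → List ℕ → List ℕ
shift x l = insertIfAbsent x (map (_∸ x) l)

shift-increasing : ∀ {x l} → Increasing (x ∷ l) → Increasing (shift x l)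
shift-increasing {x} {l} (x<l ∷ sorted , 0<x ∷ pos) =
  insert-sorted x (map-∸-sorted x<l sorted) ,
  insert-All⁺ (map (_∸ x) l) 0<x (All.map⁺ (All.map m<n⇒0<n∸m x<l))
  where
  map-∸-sorted : ∀ {L} → All (x <_) L → AllPairs _<_ L → AllPairs _<_ (map (_∸ x) L)
  map-∸-sorted [] [] = []
  map-∸-sorted (x<y ∷ x<ys) (y<ys ∷ s) =
    All.map⁺ (All.map (λ y<z → ∸-monoˡ-< y<z (<⇒≤ x<y)) y<ys) ∷ map-∸-sorted x<ys s

maxL-shift : ∀ x l → maxL (shift x l) ≡ x ⊔ (maxL l ∸ x)
maxL-shift x l =
  trans (fold-insert _⊔_ ⊔-assoc ⊔-comm ⊔-idem 0 x (map (_∸ x) l)) (cong (x ⊔_) (maxL-map-∸ x l))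

gcdL-shift : ∀ x l → All (x ≤_) l → gcdL (shift x l) ≡ gcdL (x ∷ l)
gcdL-shift x l x≤l = trans (fold-insert gcd gcd-assoc gcd-comm gcd-idem 0 x (map (_∸ x) l))
  (gcdL-unique (x ∷ map (_∸ x) l) (x ∷ l)
    (mk⇔ (λ { (d∣x ∷ ds) → d∣x ∷ restore d∣x x≤l ds })
         (λ { (d∣x ∷ ds) → d∣x ∷ reduce d∣x x≤l ds })))
  where
  restore : ∀ {d L} → d ∣ x → All (x ≤_) L → All (d ∣_) (map (_∸ x) L) → All (d ∣_) L
  restore d∣x [] [] = []
  restore d∣x (x≤y ∷ x≤ys) (d∣y∸x ∷ ds) = ∣m∸n∣n⇒∣m _ x≤y d∣y∸x d∣x ∷ restore d∣x x≤ys ds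
  reduce : ∀ {d L} → d ∣ x → All (x ≤_) L → All (d ∣_) L → All (d ∣_) (map (_∸ x) L)
  reduce d∣x [] [] = []
  reduce d∣x (x≤y ∷ x≤ys) (d∣y ∷ ds) = ∣m∣n⇒∣m∸n x≤y d∣y d∣x ∷ reduce d∣x x≤ys ds

-- R strictly decreases the maximum: this is what makes f well defined.
shift-max< : ∀ {x y ys} → Increasing (x ∷ y ∷ ys) → maxL (shift x (y ∷ ys)) < maxL (x ∷ y ∷ ys)
shift-max< {x} {y} {ys} ((x<y ∷ _) ∷ _ , 0<x ∷ _) = begin-strict
  maxL (shift x (y ∷ ys)) ≡⟨ maxL-shift x (y ∷ ys) ⟩
  x ⊔ (B ∸ x)             <⟨ ⊔-pres-<m x<B (∸-monoʳ-< 0<x (<⇒≤ x<B)) ⟩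
  B                       ≤⟨ m≤n⊔m x B ⟩
  x ⊔ B                   ∎
  where
  open ≤-Reasoning
  B = maxL (y ∷ ys)
  x<B = <-≤-trans x<y (m≤m⊔n y (maxL ys))

shift-induction : (P : List ℕ → Set) → P [] → (∀ x → P (x ∷ [])) →
  (∀ x y ys → Increasing (x ∷ y ∷ ys) → P (shift x (y ∷ ys)) → P (x ∷ y ∷ ys)) →
  ∀ q → Increasing q → P q
shift-induction P P[] P[x] step q inc = go q inc (<-wellFounded (maxL q))
  where
  go : ∀ q → Increasing q → Acc _<_ (maxL q) → P q
  go [] _ _ = P[]
  go (x ∷ []) _ _ = P[x] x
  go (x ∷ y ∷ ys) inc (acc smaller) =
    step x y ys inc (go (shift x (y ∷ ys)) (shift-increasing inc) (smaller (shift-max< inc)))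

fuel-sufficient : ∀ q → Increasing q → ∀ k → maxL q < k → fFuel k q ≡ f q
fuel-sufficient = shift-induction (λ q → ∀ k → maxL q < k → fFuel k q ≡ f q)
  (λ { (suc k) _ → refl }) (λ { x (suc k) _ → refl })
  (λ { x y ys inc ih (suc k) (s≤s max≤k) →
         cong (x +_) (trans (ih k (<-≤-trans (shift-max< inc) max≤k))
                            (sym (ih (maxL (x ∷ y ∷ ys)) (shift-max< inc)))) })

f-unfold : ∀ x l → l ≢ [] → Increasing (x ∷ l) → f (x ∷ l) ≡ x + f (shift x l)
f-unfold x [] l≢[] _ = contradiction refl l≢[]
f-unfold x (y ∷ ys) _ inc =
  cong (x +_) (fuel-sufficient _ (shift-increasing inc) _ (shift-max< inc))

-- f is at least the maximum: max(x ∷ l) = x + (max l ∸ x) ≤ x + max R ≤ x + f R.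
max≤f : ∀ q → Increasing q → maxL q ≤ f q
max≤f = shift-induction (λ q → maxL q ≤ f q) z≤n (λ x → ≤-reflexive (⊔-identityʳ x))
  λ x y ys inc ih → let B = maxL (y ∷ ys) in begin
    x ⊔ B                       ≡⟨ ⊔≡+∸ x B ⟩
    x + (B ∸ x)                 ≤⟨ +-monoʳ-≤ x (m≤n⊔m x (B ∸ x)) ⟩
    x + (x ⊔ (B ∸ x))           ≡⟨ cong (x +_) (maxL-shift x (y ∷ ys)) ⟨
    x + maxL (shift x (y ∷ ys)) ≤⟨ +-monoʳ-≤ x ih ⟩
    x + f (shift x (y ∷ ys))    ≡⟨ f-unfold x (y ∷ ys) (λ ()) inc ⟨
    f (x ∷ y ∷ ys)              ∎
  where open ≤-Reasoning

double-head≤f : ∀ x l → l ≢ [] → Increasing (x ∷ l) → x + x ≤ f (x ∷ l)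
double-head≤f x l l≢[] inc = begin
  x + x                  ≤⟨ +-monoʳ-≤ x (m≤m⊔n x (maxL l ∸ x)) ⟩
  x + (x ⊔ (maxL l ∸ x)) ≡⟨ cong (x +_) (maxL-shift x l) ⟨
  x + maxL (shift x l)   ≤⟨ +-monoʳ-≤ x (max≤f _ (shift-increasing inc)) ⟩
  x + f (shift x l)      ≡⟨ f-unfold x l l≢[] inc ⟨
  f (x ∷ l)              ∎
  where open ≤-Reasoning

-- The condition defining trimness of a list with at least two entries,
-- in terms of its gcd g, the gcd g′ of its prefix and the bound B.
TrimCond : ℕ → ℕ → Set → Set
TrimCond g g′ B = g ≢ g′ ⊎ (g ≡ g′ × B)

TrimCond-cong : ∀ {g₁ g₂ h₁ h₂ B C} → g₁ ≡ h₁ → g₂ ≡ h₂ → B ⇔ C →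
  TrimCond g₁ g₂ B ⇔ TrimCond h₁ h₂ C
TrimCond-cong refl refl B⇔C =
  mk⇔ (Sum.map₂ (Product.map₂ (to B⇔C))) (Sum.map₂ (Product.map₂ (from B⇔C)))

TrimCond-≡ : ∀ {g g′ B} → g ≡ g′ → TrimCond g g′ B ⇔ B
TrimCond-≡ g≡g′ = mk⇔ (Sum.[ (λ g≢g′ → contradiction g≡g′ g≢g′) , Product.proj₂ ])
                      (λ b → inj₂ (g≡g′ , b))

prefix-∷ʳ : ∀ a m {b} → prefix (a ∷ m ∷ʳ b) ≡ a ∷ m
prefix-∷ʳ a [] = refl
prefix-∷ʳ a (y ∷ ys) = cong (a ∷_) (prefix-∷ʳ y ys)

trim-∷ʳ : ∀ a m b → Increasing (a ∷ m ∷ʳ b) →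
  Trim (a ∷ m ∷ʳ b) ⇔ TrimCond (gcdL (a ∷ m ∷ʳ b)) (gcdL (a ∷ m)) (b < f (a ∷ m))
trim-∷ʳ a m b inc = begin
  Trim p
    ∼⟨ mk⇔ (Sum.[ not-singleton , Product.proj₂ ]) (λ c → inj₂ (long , c)) ⟩
  TrimCond (gcdL p) (gcdL (prefix p)) (maxL p < f (prefix p))
    ≡⟨ cong₂ (λ q M → TrimCond (gcdL p) (gcdL q) (M < f q))
             (prefix-∷ʳ a m) (maxL-last (a ∷ m) inc) ⟩
  TrimCond (gcdL p) (gcdL (a ∷ m)) (b < f (a ∷ m)) ∎
  where
  open EquationalReasoning
  p = a ∷ m ∷ʳ b
  nonempty : ∀ xs → 0 < length (xs ∷ʳ b)
  nonempty []      = s≤s z≤n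
  nonempty (_ ∷ _) = s≤s z≤n
  long : 1 < length p
  long = s≤s (nonempty m)
  not-singleton : length p ≡ 1 → TrimCond (gcdL p) (gcdL (prefix p)) (maxL p < f (prefix p))
  not-singleton len≡1 = contradiction long (<-irrefl (sym len≡1))

below-prefix : ∀ a m b → Increasing (a ∷ m ∷ʳ b) → b < a + a →
  gcdL (a ∷ m ∷ʳ b) ≡ gcdL (a ∷ m) → b < f (a ∷ m)
below-prefix a [] b ((a<b ∷ []) ∷ _ , _) b<2a same-gcd =
  contradiction (∣<⇒+≤ a∣b a<b) (<⇒≱ b<2a)
  where
  a∣gcd : a ∣ gcdL (a ∷ b ∷ [])
  a∣gcd = subst (a ∣_) (trans (sym (gcd-identityʳ a)) (sym same-gcd)) ∣-refl
  a∣b : a ∣ b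
  a∣b with to (∣gcdL⇔ (a ∷ b ∷ [])) a∣gcd
  ... | _ ∷ a∣b ∷ [] = a∣b
below-prefix a (y ∷ ys) b inc b<2a _ =
  <-≤-trans b<2a (double-head≤f a (y ∷ ys) (λ ()) (init-increasing (a ∷ y ∷ ys) inc))

trim-below : ∀ a m b → Increasing (a ∷ m ∷ʳ b) → b < a + a →
  Trim (a ∷ m ∷ʳ b) ⇔ b < f (a ∷ m ∷ʳ b)
trim-below a m b inc b<2a = mk⇔ (λ _ → b<f) (λ _ → from (trim-∷ʳ a m b inc) cond)
  where
  b<f : b < f (a ∷ m ∷ʳ b)
  b<f = <-≤-trans b<2a (double-head≤f a (m ∷ʳ b) (∷ʳ≢[] m) inc)
  cond : TrimCond (gcdL (a ∷ m ∷ʳ b)) (gcdL (a ∷ m)) (b < f (a ∷ m))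
  cond with gcdL (a ∷ m ∷ʳ b) ≟ gcdL (a ∷ m)
  ... | no  new-gcd  = inj₁ new-gcd
  ... | yes same-gcd = inj₂ (same-gcd , below-prefix a m b inc b<2a same-gcd)

-- At b = 2a the last entry disappears under R: its image a is already there.
shift-∷ʳ-double : ∀ a m → Increasing (a ∷ m ∷ʳ (a + a)) → shift a (m ∷ʳ (a + a)) ≡ shift a m
shift-∷ʳ-double a m inc@(a<rest ∷ _ , _) = begin
  insertIfAbsent a (map (_∸ a) (m ∷ʳ (a + a))) ≡⟨ cong (insertIfAbsent a) (map-++ (_∸ a) m _) ⟩
  insertIfAbsent a (L ∷ʳ (a + a ∸ a))          ≡⟨ cong (λ z → insertIfAbsent a (L ∷ʳ z)) (m+n∸m≡n a a) ⟩
  insertIfAbsent a (L ∷ʳ a)                    ≡⟨ cong (insertIfAbsent a) (insert-above L L<a) ⟨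
  insertIfAbsent a (insertIfAbsent a L)        ≡⟨ insert-idem a L ⟩
  insertIfAbsent a L                           ∎
  where
  open ≡-Reasoning
  L = map (_∸ a) m
  L<a : All (_< a) L
  L<a = All.map⁺ (All.zipWith
    (λ {z} (a<z , z<2a) → subst (z ∸ a <_) (m+n∸m≡n a a) (∸-monoˡ-< z<2a (<⇒≤ a<z)))
    (Product.proj₁ (All.∷ʳ⁻ a<rest) , All.tail (below-last (a ∷ m) inc)))

double-prefix⇔ : ∀ a m → Increasing (a ∷ m ∷ʳ (a + a)) →
  a + a < f (a ∷ m) ⇔ a + a < f (a ∷ m ∷ʳ (a + a))
double-prefix⇔ a [] inc =
  mk⇔ (λ 2a<a → contradiction (m≤m+n a a) (<⇒≱ 2a<a))
      (λ 2a<f → contradiction 2a<f (<-irrefl (sym f≡2a)))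
  where
  f≡2a : f (a ∷ (a + a) ∷ []) ≡ a + a
  f≡2a = trans (f-unfold a (a + a ∷ []) (λ ()) inc)
               (cong (λ r → a + f r) (shift-∷ʳ-double a [] inc))
double-prefix⇔ a m@(_ ∷ _) inc = mk⇔ (subst (a + a <_) (sym same-f)) (subst (a + a <_) same-f)
  where
  same-f : f (a ∷ m ∷ʳ (a + a)) ≡ f (a ∷ m)
  same-f = begin
    f (a ∷ m ∷ʳ (a + a))           ≡⟨ f-unfold a (m ∷ʳ (a + a)) (∷ʳ≢[] m) inc ⟩
    a + f (shift a (m ∷ʳ (a + a))) ≡⟨ cong (λ r → a + f r) (shift-∷ʳ-double a m inc) ⟩
    a + f (shift a m)              ≡⟨ f-unfold a m (λ ()) (init-increasing (a ∷ m) inc) ⟨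
    f (a ∷ m)                      ∎
    where open ≡-Reasoning

-- At b = 2a the gcd ignores the last entry, so trimness is b < f(a ∷ m).
trim-at : ∀ a m b → Increasing (a ∷ m ∷ʳ b) → b ≡ a + a →
  Trim (a ∷ m ∷ʳ b) ⇔ b < f (a ∷ m ∷ʳ b)
trim-at a m _ inc refl = begin
  Trim (a ∷ m ∷ʳ (a + a))
    ∼⟨ trim-∷ʳ a m (a + a) inc ⟩
  TrimCond (gcdL (a ∷ m ∷ʳ (a + a))) (gcdL (a ∷ m)) (a + a < f (a ∷ m))
    ∼⟨ TrimCond-≡ (gcdL-∷ʳ (a ∷ m) (a + a) λ { (d∣a ∷ _) → ∣m∣n⇒∣m+n d∣a d∣a }) ⟩
  a + a < f (a ∷ m)
    ∼⟨ double-prefix⇔ a m inc ⟩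
  a + a < f (a ∷ m ∷ʳ (a + a)) ∎
  where open EquationalReasoning

above-prefix⇔ : ∀ a m b → Increasing (a ∷ m) → a < b ∸ a →
  b < f (a ∷ m) ⇔ b ∸ a < f (shift a m)
above-prefix⇔ a [] b _ a<b∸a =
  mk⇔ (λ b<a → contradiction (<-≤-trans a<b∸a (m∸n≤m b a)) (<-asym b<a))
      (λ b∸a<a → contradiction a<b∸a (<-asym b∸a<a))
above-prefix⇔ a m@(_ ∷ _) b inc a<b∸a = begin
  b < f (a ∷ m)         ≡⟨ cong (b <_) (f-unfold a m (λ ()) inc) ⟩
  b < a + f (shift a m) ∼⟨ ⇔-sym (∸<⇔<+ (<⇒≤ (<-≤-trans a<b∸a (m∸n≤m b a)))) ⟩
  b ∸ a < f (shift a m) ∎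
  where open EquationalReasoning

TrimCriterion : ℕ → Set
TrimCriterion b = ∀ a m → Increasing (a ∷ m ∷ʳ b) → Trim (a ∷ m ∷ʳ b) ⇔ b < f (a ∷ m ∷ʳ b)

-- Above 2a, R maps a ∷ m ∷ʳ b to R(a ∷ m) ∷ʳ (b ∸ a) preserving gcds, and
-- both sides of the criterion transfer to the smaller last entry b ∸ a.
trim-above : ∀ a m b → Increasing (a ∷ m ∷ʳ b) → a + a < b →
  (∀ {e} → e < b → TrimCriterion e) → Trim (a ∷ m ∷ʳ b) ⇔ b < f (a ∷ m ∷ʳ b)
trim-above a m b inc@(a<rest ∷ _ , 0<a ∷ _) 2a<b smaller
  with insert-nonempty a (map (_∸ a) m)
... | c , K , R-prefix = begin
  Trim p                                               ∼⟨ trim-∷ʳ a m b inc ⟩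
  TrimCond (gcdL p) (gcdL (a ∷ m)) (b < f (a ∷ m))     ∼⟨ TrimCond-cong gcd-p gcd-prefix prefix⇔ ⟩
  TrimCond (gcdL q) (gcdL (c ∷ K)) (b ∸ a < f (c ∷ K)) ∼⟨ ⇔-sym (trim-∷ʳ c K (b ∸ a) q-inc) ⟩
  Trim q                                               ∼⟨ smaller b∸a<b c K q-inc ⟩
  b ∸ a < f q                                          ∼⟨ ∸<⇔<+ a≤b ⟩
  b < a + f q                                          ≡⟨ cong (b <_) f-p ⟨
  b < f p                                              ∎
  where
  open EquationalReasoning
  p = a ∷ m ∷ʳ b
  q = c ∷ K ∷ʳ (b ∸ a)
  a≤b : a ≤ b
  a≤b = ≤-trans (m≤m+n a a) (<⇒≤ 2a<b)
  a<b∸a : a < b ∸ a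
  a<b∸a = subst (_< b ∸ a) (m+n∸m≡n a a) (∸-monoˡ-< 2a<b (m≤m+n a a))
  b∸a<b : b ∸ a < b
  b∸a<b = ∸-monoʳ-< 0<a a≤b
  R-p : shift a (m ∷ʳ b) ≡ q
  R-p = trans (cong (insertIfAbsent a) (map-++ (_∸ a) m _))
              (trans (insert-∷ʳ (map (_∸ a) m) a<b∸a) (cong (_∷ʳ (b ∸ a)) R-prefix))
  q-inc : Increasing q
  q-inc = subst Increasing R-p (shift-increasing inc)
  f-p : f p ≡ a + f q
  f-p = trans (f-unfold a (m ∷ʳ b) (∷ʳ≢[] m) inc) (cong (λ r → a + f r) R-p)
  gcd-p : gcdL p ≡ gcdL q
  gcd-p = trans (sym (gcdL-shift a (m ∷ʳ b) (All.map <⇒≤ a<rest))) (cong gcdL R-p)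
  gcd-prefix : gcdL (a ∷ m) ≡ gcdL (c ∷ K)
  gcd-prefix = trans (sym (gcdL-shift a m (All.map <⇒≤ (Product.proj₁ (All.∷ʳ⁻ a<rest)))))
                     (cong gcdL R-prefix)
  prefix⇔ : b < f (a ∷ m) ⇔ b ∸ a < f (c ∷ K)
  prefix⇔ = subst (λ r → b < f (a ∷ m) ⇔ b ∸ a < f r) R-prefix
    (above-prefix⇔ a m b (init-increasing (a ∷ m) inc) a<b∸a)

trim-criterion : ∀ b → TrimCriterion b
trim-criterion = <-rec TrimCriterion criterion
  where
  criterion : ∀ b → (∀ {e} → e < b → TrimCriterion e) → TrimCriterion b
  criterion b smaller a m inc with <-cmp b (a + a)
  ... | tri< b<2a _ _ = trim-below a m b inc b<2a
  ... | tri≈ _ b≡2a _ = trim-at a m b inc b≡2a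
  ... | tri> _ _ 2a<b = trim-above a m b inc 2a<b smaller

trim⇔max<f : ∀ q → Increasing q → 1 < length q → Trim q ⇔ maxL q < f q
trim⇔max<f q inc long with initLast q
... | [] = contradiction long λ ()
... | [] ∷ʳ′ b = contradiction long λ { (s≤s ()) }
... | (a ∷ m) ∷ʳ′ b =
  subst (λ M → Trim (a ∷ m ∷ʳ b) ⇔ M < f (a ∷ m ∷ʳ b)) (sym (maxL-last (a ∷ m) inc))
        (trim-criterion b a m inc)

not-trim⇒f≡max : ∀ q → Increasing q → ¬ Trim q → f q ≡ maxL q
not-trim⇒f≡max [] _ _ = refl
not-trim⇒f≡max (x ∷ []) _ not-trim = contradiction (inj₁ refl) not-trim
not-trim⇒f≡max q@(_ ∷ _ ∷ _) inc not-trim = ≤-antisym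
  (≮⇒≥ λ max<f → not-trim (from (trim⇔max<f q inc (s≤s (s≤s z≤n))) max<f))
  (max≤f q inc)

f-when-R-not-trim : ∀ x l → l ≢ [] → Increasing (x ∷ l) → ¬ Trim (shift x l) →
  f (x ∷ l) ≡ x + (x ⊔ (maxL l ∸ x))
f-when-R-not-trim x l l≢[] inc not-trim = begin
  f (x ∷ l)              ≡⟨ f-unfold x l l≢[] inc ⟩
  x + f (shift x l)      ≡⟨ cong (x +_) (not-trim⇒f≡max _ (shift-increasing inc) not-trim) ⟩
  x + maxL (shift x l)   ≡⟨ cong (x +_) (maxL-shift x l) ⟩
  x + (x ⊔ (maxL l ∸ x)) ∎
  where open ≡-Reasoning

-- If x + (x ⊔ (B ∸ x)) exceeds x ⊔ B = x + (B ∸ x), the inner maximum is x.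
exceeds-max⇒double : ∀ x B → x ⊔ B < x + (x ⊔ (B ∸ x)) → x + (x ⊔ (B ∸ x)) ≡ 2 * x
exceeds-max⇒double x B exceeds with ⊔-sel x (B ∸ x)
... | inj₁ max≡x = cong (x +_) (trans max≡x (sym (+-identityʳ x)))
... | inj₂ max≡B∸x =
  contradiction (subst (x ⊔ B <_) (trans (cong (x +_) max≡B∸x) (sym (⊔≡+∸ x B))) exceeds) (<-irrefl refl)

proposition14 : (x : ℕ) (xs : List ℕ) → OFS (x ∷ xs) → Trim (x ∷ xs) → 1 < length (x ∷ xs)
    → maxL (x ∷ xs) < f (x ∷ xs) × (¬ Trim (R (x ∷ xs)) → f (x ∷ xs) ≡ 2 * x)
proposition14 x [] _ _ (s≤s ())
proposition14 x xs@(_ ∷ _) ofs trim long = max<f , R-not-trim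
  where
  inc : Increasing (x ∷ xs)
  inc = ofs⇒increasing ofs
  max<f : maxL (x ∷ xs) < f (x ∷ xs)
  max<f = to (trim⇔max<f (x ∷ xs) inc long) trim
  R-not-trim : ¬ Trim (R (x ∷ xs)) → f (x ∷ xs) ≡ 2 * x
  R-not-trim not-trim =
    trans f-eq (exceeds-max⇒double x (maxL xs) (subst (maxL (x ∷ xs) <_) f-eq max<f))
    where
    f-eq : f (x ∷ xs) ≡ x + (x ⊔ (maxL xs ∸ x))
    f-eq = f-when-R-not-trim x xs (λ ()) inc not-trim
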